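{- Let $K$ be an algebraically closed field of characteristic $0$, let $f,g\in K[t]$ be nonconstant relatively prime polynomials, put $A=f^2-g^2$, $B=2fg$, $C=f^2+g^2$, and let $w\in K[t]$ be a nonzero polynomial. Let $m\le n$ be positive integers such that $(wA)^n=(wC)^m-(wB)^m$. Then $m\le 2$. -}

module Defs where

open import Level using (_⊔_)
open import Algebra.Bundles using (CommutativeRing)
open import Data.Nat using (ℕ; zero; suc)
open import Data.List using (List; []; _∷_; map; foldr)
open import Data.Product using (∃; _×_)
open import Relation.Nullary using (¬_)

-- Univariate polynomials over a commutative ring R, represented by
-- coefficient lists (lowest degree first); equality is coefficientwise
-- (so trailing zeros are irrelevant).
module Poly {c ℓ} (R : CommutativeRing c ℓ) where
  open CommutativeRing R

  Pol : Set c
  Pol = List Carrier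

  coeff : Pol → ℕ → Carrier
  coeff []      _       = 0#
  coeff (a ∷ p) zero    = a
  coeff (a ∷ p) (suc i) = coeff p i

  infix 4 _≈ₚ_
  _≈ₚ_ : Pol → Pol → Set ℓ
  p ≈ₚ q = ∀ i → coeff p i ≈ coeff q i

  0ₚ : Pol
  0ₚ = []

  const : Carrier → Pol
  const a = a ∷ []

  1ₚ : Pol
  1ₚ = const 1#

  infixl 6 _+ₚ_ _-ₚ_
  infixl 7 _*ₚ_
  infixr 8 _^ₚ_

  _+ₚ_ : Pol → Pol → Pol
  []      +ₚ q       = q
  (a ∷ p) +ₚ []      = a ∷ p
  (a ∷ p) +ₚ (b ∷ q) = (a + b) ∷ (p +ₚ q)

  -ₚ_ : Pol → Pol
  -ₚ p = map -_ p

  _-ₚ_ : Pol → Pol → Pol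
  p -ₚ q = p +ₚ (-ₚ q)

  _*ₚ_ : Pol → Pol → Pol
  []      *ₚ q = []
  (a ∷ p) *ₚ q = map (a *_) q +ₚ (0# ∷ (p *ₚ q))

  _^ₚ_ : Pol → ℕ → Pol
  p ^ₚ zero  = 1ₚ
  p ^ₚ suc n = p *ₚ (p ^ₚ n)

  eval : Pol → Carrier → Carrier
  eval p x = foldr (λ a acc → a + x * acc) 0# p

  _∣ₚ_ : Pol → Pol → Set (c ⊔ ℓ)
  d ∣ₚ p = ∃ λ q → d *ₚ q ≈ₚ p

  Coprime : Pol → Pol → Set (c ⊔ ℓ)
  Coprime f g = ∀ d → d ∣ₚ f → d ∣ₚ g → d ∣ₚ 1ₚ

  NonConstant : Pol → Set (c ⊔ ℓ)
  NonConstant p = ¬ (∃ λ a → p ≈ₚ const a)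

  IsField : Set (c ⊔ ℓ)
  IsField = (¬ (1# ≈ 0#)) × (∀ x → ¬ (x ≈ 0#) → ∃ λ y → x * y ≈ 1#)

  fromℕ : ℕ → Carrier
  fromℕ zero    = 0#
  fromℕ (suc n) = 1# + fromℕ n

  Char0 : Set ℓ
  Char0 = ∀ n → ¬ (fromℕ (suc n) ≈ 0#)

  AlgClosed : Set (c ⊔ ℓ)
  AlgClosed = ∀ p → NonConstant p → ∃ λ x → eval p x ≈ 0#

  polA : Pol → Pol → Pol
  polA f g = f *ₚ f -ₚ g *ₚ g

  polB : Pol → Pol → Pol
  polB f g = const (1# + 1#) *ₚ f *ₚ g

  polC : Pol → Pol → Pol
  polC f g = f *ₚ f +ₚ g *ₚ g

-- Since A² + B² = C², multiplying the equation by C^m + B^m gives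
--   (wA)^n (C^m + B^m) = w^m (C^2m - B^2m) = w^m A² (C^2(m-1) + C^2(m-2) B² + ... + B^2(m-1)).
-- Cancelling w^m A² in the domain K[t] leaves a factor A on the left as soon as n ≥ 3.
-- A = (f - g)(f + g) has a root r, at which f(r), g(r) ≠ 0 by coprimality, so that
-- C(r)² = B(r)² ≠ 0 and the right-hand side evaluates to m B(r)^2(m-1) ≠ 0 in
-- characteristic 0. Hence n ≤ 2, and so m ≤ 2.
-- Equality in K is not decidable, but every case split is made towards a negated goal,
-- where excluded middle is available through ¬¬-excluded-middle.

module Submission where

open import Defs
open import Algebra.Bundles using (CommutativeRing)
open import Data.Nat using (ℕ; zero; suc; _≤_; _≤?_; s≤s; z≤n)
import Data.Nat as ℕ
open import Data.Nat.Properties using (≤-trans; ≰⇒>; m≤n⇒∃[o]m+o≡n)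
open import Data.List using ([]; _∷_; map)
open import Data.Product using (∃; _,_; proj₁; proj₂)
open import Data.Empty using (⊥-elim)
open import Level using (_⊔_)
open import Relation.Nullary using (¬_; yes; no)
open import Relation.Nullary.Decidable using (¬¬-excluded-middle)
open import Relation.Binary.PropositionalEquality using (_≡_)

module RingFacts {c ℓ} (R : CommutativeRing c ℓ) where
  open CommutativeRing R
  open Poly R using (IsField; fromℕ)
  open import Algebra.Properties.Semiring.Exp semiring public using (_^_)
  open import Algebra.Properties.Group +-group using (∙-cancelʳ; //-rightDividesˡ; x≈z//y; x∙y⁻¹≈ε⇒x≈y; x≈y⇒x∙y⁻¹≈ε)
  open import Algebra.Properties.Ring ring using (x[y-z]≈xy-xz)
  open import Algebra.Properties.Semiring.Exp semiring using (^-congˡ; ^-congʳ; ^-homo-*)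
  open import Algebra.Properties.CommutativeSemiring.Exp commutativeSemiring using (^-distrib-*)
  open import Algebra.Solver.Ring.NaturalCoefficients.Default commutativeSemiring
  open import Relation.Binary.Reasoning.Setoid setoid

  x≈y-z⇒x+z≈y : ∀ {x y z} → x ≈ y - z → x + z ≈ y
  x≈y-z⇒x+z≈y {y = y} {z} x≈y-z = trans (+-congʳ x≈y-z) (//-rightDividesˡ z y)

  [x-y][x+y]≈x²-y² : ∀ x y → (x - y) * (x + y) ≈ x * x - y * y
  [x-y][x+y]≈x²-y² x y = x≈z//y ((x - y) * (x + y)) (y * y) (x * x) (begin
    h * (x + y) + y * y        ≈⟨ +-congʳ (*-congˡ (+-congʳ h+y≈x)) ⟨
    h * ((h + y) + y) + y * y  ≈⟨ solve 2 (λ h y → h :* ((h :+ y) :+ y) :+ y :* y := (h :+ y) :* (h :+ y)) refl h y ⟩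
    (h + y) * (h + y)          ≈⟨ *-cong h+y≈x h+y≈x ⟩
    x * x                      ∎)
    where
    h = x - y
    h+y≈x : h + y ≈ x
    h+y≈x = //-rightDividesˡ y x

  pythagorean : ∀ x y →
    (x * x - y * y) * (x * x - y * y) + ((1# + 1#) * x * y) * ((1# + 1#) * x * y) ≈ (x * x + y * y) * (x * x + y * y)
  pythagorean x y = begin
    d * d + (two * x * y) * (two * x * y)      ≈⟨ +-congˡ (solve 3 (λ t x y → (t :* x :* y) :* (t :* x :* y) := t :* t :* (x :* x) :* (y :* y)) refl two x y) ⟩
    d * d + two * two * (x * x) * (y * y)      ≈⟨ +-congˡ (*-congʳ (*-congˡ d+y²≈x²)) ⟨
    d * d + two * two * (d + y * y) * (y * y)  ≈⟨ solve 2 (λ d y → d :* d :+ (con 1 :+ con 1) :* (con 1 :+ con 1) :* (d :+ y :* y) :* (y :* y) := (d :+ y :* y :+ y :* y) :* (d :+ y :* y :+ y :* y)) refl d y ⟩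
    (d + y * y + y * y) * (d + y * y + y * y)  ≈⟨ *-cong d+2y²≈x²+y² d+2y²≈x²+y² ⟩
    (x * x + y * y) * (x * x + y * y)          ∎
    where
    d = x * x - y * y
    two = 1# + 1#
    d+y²≈x² : d + y * y ≈ x * x
    d+y²≈x² = //-rightDividesˡ (y * y) (x * x)
    d+2y²≈x²+y² : d + y * y + y * y ≈ x * x + y * y
    d+2y²≈x²+y² = +-congʳ d+y²≈x²

  x≈u*[[x-y]+[x+y]] : ∀ {u} x y → u * (1# + 1#) ≈ 1# → x ≈ u * ((x - y) + (x + y))
  x≈u*[[x-y]+[x+y]] {u} x y u*2≈1 = begin
    x                        ≈⟨ *-identityˡ x ⟨
    1# * x                   ≈⟨ *-congʳ u*2≈1 ⟨
    u * (1# + 1#) * x        ≈⟨ *-congˡ h+y≈x ⟨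
    u * (1# + 1#) * (h + y)  ≈⟨ solve 3 (λ u h y → u :* (con 1 :+ con 1) :* (h :+ y) := u :* (h :+ ((h :+ y) :+ y))) refl u h y ⟩
    u * (h + ((h + y) + y))  ≈⟨ *-congˡ (+-congˡ (+-congʳ h+y≈x)) ⟩
    u * (h + (x + y))        ∎
    where
    h = x - y
    h+y≈x : h + y ≈ x
    h+y≈x = //-rightDividesˡ y x

  geometricSum : Carrier → Carrier → ℕ → Carrier
  geometricSum x y zero    = 0#
  geometricSum x y (suc k) = x ^ k + y * geometricSum x y k

  geometricSum-cong : ∀ {x x′ y y′} k → x ≈ x′ → y ≈ y′ → geometricSum x y k ≈ geometricSum x′ y′ k
  geometricSum-cong zero    x≈x′ y≈y′ = refl
  geometricSum-cong (suc k) x≈x′ y≈y′ = +-cong (^-congˡ k x≈x′) (*-cong y≈y′ (geometricSum-cong k x≈x′ y≈y′))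

  x≈y+z⇒x^k≈y^k+z*geometricSum : ∀ {x y z} k → x ≈ y + z → x ^ k ≈ y ^ k + z * geometricSum x y k
  x≈y+z⇒x^k≈y^k+z*geometricSum {z = z} zero x≈y+z = sym (trans (+-congˡ (zeroʳ z)) (+-identityʳ 1#))
  x≈y+z⇒x^k≈y^k+z*geometricSum {x} {y} {z} (suc k) x≈y+z = begin
    x * x ^ k                                  ≈⟨ *-cong x≈y+z IH ⟩
    (y + z) * (y ^ k + z * G)                  ≈⟨ solve 4 (λ y z Y G → (y :+ z) :* (Y :+ z :* G) := y :* Y :+ z :* ((Y :+ z :* G) :+ y :* G)) refl y z (y ^ k) G ⟩
    y * y ^ k + z * ((y ^ k + z * G) + y * G)  ≈⟨ +-congˡ (*-congˡ (+-congʳ IH)) ⟨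
    y * y ^ k + z * (x ^ k + y * G)            ∎
    where
    G = geometricSum x y k
    IH = x≈y+z⇒x^k≈y^k+z*geometricSum k x≈y+z

  geometricSum-diagonal : ∀ x k → geometricSum x x (suc k) ≈ fromℕ (suc k) * x ^ k
  geometricSum-diagonal x zero = solve 1 (λ x → con 1 :+ x :* con 0 := (con 1 :+ con 0) :* con 1) refl x
  geometricSum-diagonal x (suc k) = begin
    x * x ^ k + x * geometricSum x x (suc k)  ≈⟨ +-congˡ (*-congˡ (geometricSum-diagonal x k)) ⟩
    x * x ^ k + x * (n * x ^ k)               ≈⟨ solve 3 (λ x X n → x :* X :+ x :* (n :* X) := (con 1 :+ n) :* (x :* X)) refl x (x ^ k) n ⟩
    (1# + n) * (x * x ^ k)                    ∎
    where n = fromℕ (suc k)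

  power-equation-factorised : ∀ {W A B C} m d k → m ℕ.+ d ≡ 2 ℕ.+ k → A * A + B * B ≈ C * C →
    (W * A) ^ (2 ℕ.+ k) + (W * B) ^ m ≈ (W * C) ^ m →
    (W ^ m * (A * A)) * ((W ^ d * A ^ k) * (C ^ m + B ^ m)) ≈ (W ^ m * (A * A)) * geometricSum (C * C) (B * B) m
  power-equation-factorised {W} {A} {B} {C} m d k m+d≡2+k A²+B²≈C² eq = ∙-cancelʳ (X * Bᵐ * (Cᵐ + Bᵐ)) _ _ (begin
    X * A² * (Y * (Cᵐ + Bᵐ)) + X * Bᵐ * (Cᵐ + Bᵐ)
      ≈⟨ solve 5 (λ X A² Y Cᵐ Bᵐ → X :* A² :* (Y :* (Cᵐ :+ Bᵐ)) :+ X :* Bᵐ :* (Cᵐ :+ Bᵐ) := (X :* A² :* Y :+ X :* Bᵐ) :* (Cᵐ :+ Bᵐ)) refl X A² Y Cᵐ Bᵐ ⟩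
    (X * A² * Y + X * Bᵐ) * (Cᵐ + Bᵐ)
      ≈⟨ *-congʳ eq′ ⟩
    X * Cᵐ * (Cᵐ + Bᵐ)
      ≈⟨ solve 3 (λ X Cᵐ Bᵐ → X :* Cᵐ :* (Cᵐ :+ Bᵐ) := X :* (Cᵐ :* Cᵐ) :+ X :* Cᵐ :* Bᵐ) refl X Cᵐ Bᵐ ⟩
    X * (Cᵐ * Cᵐ) + X * Cᵐ * Bᵐ
      ≈⟨ +-congʳ (*-congˡ Cᵐ²≈Bᵐ²+A²G) ⟩
    X * (Bᵐ * Bᵐ + A² * G) + X * Cᵐ * Bᵐ
      ≈⟨ solve 5 (λ X A² G Cᵐ Bᵐ → X :* (Bᵐ :* Bᵐ :+ A² :* G) :+ X :* Cᵐ :* Bᵐ := X :* A² :* G :+ X :* Bᵐ :* (Cᵐ :+ Bᵐ)) refl X A² G Cᵐ Bᵐ ⟩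
    X * A² * G + X * Bᵐ * (Cᵐ + Bᵐ) ∎)
    where
    X = W ^ m
    A² = A * A
    Y = W ^ d * A ^ k
    Cᵐ = C ^ m
    Bᵐ = B ^ m
    G = geometricSum (C * C) (B * B) m

    [WA]^[2+k]≈XA²Y : (W * A) ^ (2 ℕ.+ k) ≈ X * A² * Y
    [WA]^[2+k]≈XA²Y = begin
      (W * A) ^ (2 ℕ.+ k)                ≈⟨ ^-distrib-* W A (2 ℕ.+ k) ⟩
      W ^ (2 ℕ.+ k) * A ^ (2 ℕ.+ k)      ≈⟨ *-congʳ (^-congʳ W m+d≡2+k) ⟨
      W ^ (m ℕ.+ d) * (A * (A * A ^ k))  ≈⟨ *-congʳ (^-homo-* W m d) ⟩
      X * W ^ d * (A * (A * A ^ k))      ≈⟨ solve 4 (λ X Wᵈ A Aᵏ → X :* Wᵈ :* (A :* (A :* Aᵏ)) := X :* (A :* A) :* (Wᵈ :* Aᵏ)) refl X (W ^ d) A (A ^ k) ⟩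
      X * A² * Y                         ∎

    eq′ : X * A² * Y + X * Bᵐ ≈ X * Cᵐ
    eq′ = begin
      X * A² * Y + X * Bᵐ                ≈⟨ +-cong [WA]^[2+k]≈XA²Y (^-distrib-* W B m) ⟨
      (W * A) ^ (2 ℕ.+ k) + (W * B) ^ m  ≈⟨ eq ⟩
      (W * C) ^ m                        ≈⟨ ^-distrib-* W C m ⟩
      X * Cᵐ                             ∎

    Cᵐ²≈Bᵐ²+A²G : Cᵐ * Cᵐ ≈ Bᵐ * Bᵐ + A² * G
    Cᵐ²≈Bᵐ²+A²G = begin
      Cᵐ * Cᵐ               ≈⟨ ^-distrib-* C C m ⟨
      (C * C) ^ m           ≈⟨ x≈y+z⇒x^k≈y^k+z*geometricSum m (trans (sym A²+B²≈C²) (+-comm A² (B * B))) ⟩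
      (B * B) ^ m + A² * G  ≈⟨ +-congʳ (^-distrib-* B B m) ⟩
      Bᵐ * Bᵐ + A² * G      ∎

  NoZeroDivisors : Set (c ⊔ ℓ)
  NoZeroDivisors = ∀ {x y} → ¬ x ≈ 0# → ¬ y ≈ 0# → ¬ x * y ≈ 0#

  ^-nonzero : NoZeroDivisors → ¬ 1# ≈ 0# → ∀ {x} → ¬ x ≈ 0# → ∀ k → ¬ x ^ k ≈ 0#
  ^-nonzero noZeroDivisors 1≉0 x≉0 zero    = 1≉0
  ^-nonzero noZeroDivisors 1≉0 x≉0 (suc k) = noZeroDivisors x≉0 (^-nonzero noZeroDivisors 1≉0 x≉0 k)

  *-cancelˡ-nonzero : NoZeroDivisors → ∀ {x y z} → ¬ x ≈ 0# → x * y ≈ x * z → ¬ ¬ y ≈ z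
  *-cancelˡ-nonzero noZeroDivisors {x} {y} {z} x≉0 xy≈xz y≉z =
    noZeroDivisors x≉0 (λ y-z≈0 → y≉z (x∙y⁻¹≈ε⇒x≈y y z y-z≈0)) (trans (x[y-z]≈xy-xz x y z) (x≈y⇒x∙y⁻¹≈ε xy≈xz))

  module _ (isField : IsField) where
    x≉0∧xy≈0⇒y≈0 : ∀ {x y} → ¬ x ≈ 0# → x * y ≈ 0# → y ≈ 0#
    x≉0∧xy≈0⇒y≈0 {x} {y} x≉0 xy≈0 with proj₂ isField x x≉0
    ... | x⁻¹ , xx⁻¹≈1 = begin
      y              ≈⟨ *-identityˡ y ⟨
      1# * y         ≈⟨ *-congʳ xx⁻¹≈1 ⟨
      x * x⁻¹ * y    ≈⟨ solve 3 (λ x x⁻¹ y → x :* x⁻¹ :* y := x⁻¹ :* (x :* y)) refl x x⁻¹ y ⟩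
      x⁻¹ * (x * y)  ≈⟨ *-congˡ xy≈0 ⟩
      x⁻¹ * 0#       ≈⟨ zeroʳ x⁻¹ ⟩
      0#             ∎

    field⇒noZeroDivisors : NoZeroDivisors
    field⇒noZeroDivisors x≉0 y≉0 xy≈0 = y≉0 (x≉0∧xy≈0⇒y≈0 x≉0 xy≈0)

module Polynomials {c ℓ} (R : CommutativeRing c ℓ) where
  open CommutativeRing R
  open Poly R
  open RingFacts R using (_^_; geometricSum; x≉0∧xy≈0⇒y≈0)
  open import Algebra.Properties.Ring ring using (-0#≈0#; -‿distribʳ-*)
  open import Algebra.Properties.AbelianGroup +-abelianGroup using (⁻¹-∙-comm)
  open import Algebra.Solver.Ring.NaturalCoefficients.Default commutativeSemiring
  open import Relation.Binary.Reasoning.Setoid setoid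

  scale : Carrier → Pol → Pol
  scale a = map (a *_)

  coeff-+ₚ : ∀ p q i → coeff (p +ₚ q) i ≈ coeff p i + coeff q i
  coeff-+ₚ []      q       i       = sym (+-identityˡ _)
  coeff-+ₚ (a ∷ p) []      i       = sym (+-identityʳ _)
  coeff-+ₚ (a ∷ p) (b ∷ q) zero    = refl
  coeff-+ₚ (a ∷ p) (b ∷ q) (suc i) = coeff-+ₚ p q i

  coeff-negₚ : ∀ p i → coeff (-ₚ p) i ≈ - coeff p i
  coeff-negₚ []      i       = sym -0#≈0#
  coeff-negₚ (a ∷ p) zero    = refl
  coeff-negₚ (a ∷ p) (suc i) = coeff-negₚ p i

  coeff-scale : ∀ a p i → coeff (scale a p) i ≈ a * coeff p i
  coeff-scale a []      i       = sym (zeroʳ a)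
  coeff-scale a (b ∷ p) zero    = refl
  coeff-scale a (b ∷ p) (suc i) = coeff-scale a p i

  -- _≈ₚ_ wrapped in a record, so that the polynomials it relates can be inferred.
  infix 4 _≋_
  record _≋_ (p q : Pol) : Set ℓ where
    constructor mk≋
    field coeff-≈ : p ≈ₚ q
  open _≋_ public

  ≋-refl : ∀ {p} → p ≋ p
  ≋-refl = mk≋ λ i → refl

  ≋-sym : ∀ {p q} → p ≋ q → q ≋ p
  ≋-sym (mk≋ p≈q) = mk≋ λ i → sym (p≈q i)

  ≋-trans : ∀ {p q r} → p ≋ q → q ≋ r → p ≋ r
  ≋-trans (mk≋ p≈q) (mk≋ q≈r) = mk≋ λ i → trans (p≈q i) (q≈r i)

  []≋[0] : [] ≋ 0# ∷ []
  []≋[0] = mk≋ λ { zero → refl ; (suc i) → refl }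

  ∷-cong : ∀ {a b p q} → a ≈ b → p ≋ q → a ∷ p ≋ b ∷ q
  ∷-cong a≈b (mk≋ p≈q) = mk≋ λ { zero → a≈b ; (suc i) → p≈q i }

  +ₚ-cong : ∀ {p p′ q q′} → p ≋ p′ → q ≋ q′ → p +ₚ q ≋ p′ +ₚ q′
  +ₚ-cong {p} {p′} {q} {q′} (mk≋ p≈p′) (mk≋ q≈q′) = mk≋ λ i →
    trans (coeff-+ₚ p q i) (trans (+-cong (p≈p′ i) (q≈q′ i)) (sym (coeff-+ₚ p′ q′ i)))

  -ₚ-cong : ∀ {p p′} → p ≋ p′ → -ₚ p ≋ -ₚ p′
  -ₚ-cong {p} {p′} (mk≋ p≈p′) = mk≋ λ i →
    trans (coeff-negₚ p i) (trans (-‿cong (p≈p′ i)) (sym (coeff-negₚ p′ i)))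

  scale-cong : ∀ {a a′ p p′} → a ≈ a′ → p ≋ p′ → scale a p ≋ scale a′ p′
  scale-cong {a} {a′} {p} {p′} a≈a′ (mk≋ p≈p′) = mk≋ λ i →
    trans (coeff-scale a p i) (trans (*-cong a≈a′ (p≈p′ i)) (sym (coeff-scale a′ p′ i)))

  +ₚ-assoc : ∀ p q r → (p +ₚ q) +ₚ r ≋ p +ₚ (q +ₚ r)
  +ₚ-assoc p q r = mk≋ λ i → begin
    coeff ((p +ₚ q) +ₚ r) i              ≈⟨ trans (coeff-+ₚ (p +ₚ q) r i) (+-congʳ (coeff-+ₚ p q i)) ⟩
    coeff p i + coeff q i + coeff r i    ≈⟨ +-assoc _ _ _ ⟩
    coeff p i + (coeff q i + coeff r i)  ≈⟨ trans (coeff-+ₚ p (q +ₚ r) i) (+-congˡ (coeff-+ₚ q r i)) ⟨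
    coeff (p +ₚ (q +ₚ r)) i              ∎

  +ₚ-comm : ∀ p q → p +ₚ q ≋ q +ₚ p
  +ₚ-comm p q = mk≋ λ i → trans (coeff-+ₚ p q i) (trans (+-comm _ _) (sym (coeff-+ₚ q p i)))

  +ₚ-identityʳ : ∀ p → p +ₚ [] ≋ p
  +ₚ-identityʳ p = mk≋ λ i → trans (coeff-+ₚ p [] i) (+-identityʳ _)

  -ₚ-inverseˡ : ∀ p → -ₚ p +ₚ p ≋ []
  -ₚ-inverseˡ p = mk≋ λ i → trans (coeff-+ₚ (-ₚ p) p i) (trans (+-congʳ (coeff-negₚ p i)) (-‿inverseˡ _))

  -ₚ-inverseʳ : ∀ p → p +ₚ -ₚ p ≋ []
  -ₚ-inverseʳ p = ≋-trans (+ₚ-comm p (-ₚ p)) (-ₚ-inverseˡ p)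

  +ₚ-lcomm : ∀ p q r → p +ₚ (q +ₚ r) ≋ q +ₚ (p +ₚ r)
  +ₚ-lcomm p q r = ≋-trans (≋-sym (+ₚ-assoc p q r)) (≋-trans (+ₚ-cong (+ₚ-comm p q) ≋-refl) (+ₚ-assoc q p r))

  +ₚ-interchange : ∀ p q r s → (p +ₚ q) +ₚ (r +ₚ s) ≋ (p +ₚ r) +ₚ (q +ₚ s)
  +ₚ-interchange p q r s =
    ≋-trans (+ₚ-assoc p q (r +ₚ s)) (≋-trans (+ₚ-cong (≋-refl {p}) (+ₚ-lcomm q r s)) (≋-sym (+ₚ-assoc p r (q +ₚ s))))

  scale-distrib-+ₚ : ∀ a p q → scale a (p +ₚ q) ≋ scale a p +ₚ scale a q
  scale-distrib-+ₚ a p q = mk≋ λ i → begin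
    coeff (scale a (p +ₚ q)) i              ≈⟨ trans (coeff-scale a (p +ₚ q) i) (*-congˡ (coeff-+ₚ p q i)) ⟩
    a * (coeff p i + coeff q i)             ≈⟨ distribˡ a _ _ ⟩
    a * coeff p i + a * coeff q i           ≈⟨ trans (coeff-+ₚ (scale a p) (scale a q) i) (+-cong (coeff-scale a p i) (coeff-scale a q i)) ⟨
    coeff (scale a p +ₚ scale a q) i        ∎

  scale-scale : ∀ a b p → scale a (scale b p) ≋ scale (a * b) p
  scale-scale a b p = mk≋ λ i →
    trans (coeff-scale a (scale b p) i) (trans (*-congˡ (coeff-scale b p i)) (trans (sym (*-assoc _ _ _)) (sym (coeff-scale (a * b) p i))))

  scale-≈0 : ∀ {a} p → a ≈ 0# → scale a p ≋ []
  scale-≈0 {a} p a≈0 = mk≋ λ i → trans (coeff-scale a p i) (trans (*-congʳ a≈0) (zeroˡ _))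

  scale-1 : ∀ p → scale 1# p ≋ p
  scale-1 p = mk≋ λ i → trans (coeff-scale 1# p i) (*-identityˡ _)

  *ₚ-congʳ : ∀ p {q q′} → q ≋ q′ → p *ₚ q ≋ p *ₚ q′
  *ₚ-congʳ []      q≋q′ = ≋-refl
  *ₚ-congʳ (a ∷ p) q≋q′ = +ₚ-cong (scale-cong refl q≋q′) (∷-cong refl (*ₚ-congʳ p q≋q′))

  *ₚ-zeroʳ : ∀ p → p *ₚ [] ≋ []
  *ₚ-zeroʳ []      = ≋-refl
  *ₚ-zeroʳ (a ∷ p) = ≋-trans (∷-cong refl (*ₚ-zeroʳ p)) (≋-sym []≋[0])

  *ₚ-∷ : ∀ p b q → p *ₚ (b ∷ q) ≋ scale b p +ₚ (0# ∷ p *ₚ q)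
  *ₚ-∷ []      b q = []≋[0]
  *ₚ-∷ (a ∷ p) b q = ∷-cong (+-congʳ (*-comm a b))
    (≋-trans (+ₚ-cong (≋-refl {scale a q}) (*ₚ-∷ p b q)) (+ₚ-lcomm (scale a q) (scale b p) (0# ∷ p *ₚ q)))

  *ₚ-comm : ∀ p q → p *ₚ q ≋ q *ₚ p
  *ₚ-comm []      q = ≋-sym (*ₚ-zeroʳ q)
  *ₚ-comm (a ∷ p) q = ≋-trans (+ₚ-cong (≋-refl {scale a q}) (∷-cong refl (*ₚ-comm p q))) (≋-sym (*ₚ-∷ q a p))

  *ₚ-cong : ∀ {p p′ q q′} → p ≋ p′ → q ≋ q′ → p *ₚ q ≋ p′ *ₚ q′
  *ₚ-cong {p} {p′} {q} {q′} p≋p′ q≋q′ =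
    ≋-trans (*ₚ-comm p q) (≋-trans (*ₚ-congʳ q p≋p′) (≋-trans (*ₚ-comm q p′) (*ₚ-congʳ p′ q≋q′)))

  *ₚ-distribˡ : ∀ p q r → p *ₚ (q +ₚ r) ≋ p *ₚ q +ₚ p *ₚ r
  *ₚ-distribˡ []      q r = ≋-refl
  *ₚ-distribˡ (a ∷ p) q r =
    ≋-trans (+ₚ-cong (scale-distrib-+ₚ a q r) (∷-cong (sym (+-identityˡ 0#)) (*ₚ-distribˡ p q r)))
            (+ₚ-interchange (scale a q) (scale a r) (0# ∷ p *ₚ q) (0# ∷ p *ₚ r))

  *ₚ-distribʳ : ∀ r p q → (p +ₚ q) *ₚ r ≋ p *ₚ r +ₚ q *ₚ r
  *ₚ-distribʳ r p q =
    ≋-trans (*ₚ-comm (p +ₚ q) r) (≋-trans (*ₚ-distribˡ r p q) (+ₚ-cong (*ₚ-comm r p) (*ₚ-comm r q)))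

  scale-*ₚ : ∀ a q r → scale a q *ₚ r ≋ scale a (q *ₚ r)
  scale-*ₚ a []      r = ≋-refl
  scale-*ₚ a (b ∷ q) r = ≋-sym (≋-trans (scale-distrib-+ₚ a (scale b r) (0# ∷ q *ₚ r))
    (+ₚ-cong (scale-scale a b r) (∷-cong (zeroʳ a) (≋-sym (scale-*ₚ a q r)))))

  *ₚ-assoc : ∀ p q r → (p *ₚ q) *ₚ r ≋ p *ₚ (q *ₚ r)
  *ₚ-assoc []      q r = ≋-refl
  *ₚ-assoc (a ∷ p) q r = ≋-trans (*ₚ-distribʳ r (scale a q) (0# ∷ p *ₚ q))
    (+ₚ-cong (scale-*ₚ a q r) (≋-trans (+ₚ-cong (scale-≈0 r refl) ≋-refl) (∷-cong refl (*ₚ-assoc p q r))))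

  *ₚ-identityˡ : ∀ p → 1ₚ *ₚ p ≋ p
  *ₚ-identityˡ p = ≋-trans (+ₚ-cong (scale-1 p) (≋-sym []≋[0])) (+ₚ-identityʳ p)

  polyRing : CommutativeRing c ℓ
  polyRing = record
    { Carrier = Pol ; _≈_ = _≋_ ; _+_ = _+ₚ_ ; _*_ = _*ₚ_ ; -_ = -ₚ_ ; 0# = [] ; 1# = 1ₚ
    ; isCommutativeRing = record
      { isRing = record
        { +-isAbelianGroup = record
          { isGroup = record
            { isMonoid = record
              { isSemigroup = record
                { isMagma = record
                  { isEquivalence = record { refl = ≋-refl ; sym = ≋-sym ; trans = ≋-trans }
                  ; ∙-cong = +ₚ-cong }
                ; assoc = +ₚ-assoc }
              ; identity = (λ p → ≋-refl) , +ₚ-identityʳ }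
            ; inverse = -ₚ-inverseˡ , -ₚ-inverseʳ
            ; ⁻¹-cong = -ₚ-cong }
          ; comm = +ₚ-comm }
        ; *-cong = *ₚ-cong
        ; *-assoc = *ₚ-assoc
        ; *-identity = *ₚ-identityˡ , (λ p → ≋-trans (*ₚ-comm p 1ₚ) (*ₚ-identityˡ p))
        ; distrib = *ₚ-distribˡ , *ₚ-distribʳ }
      ; *-comm = *ₚ-comm } }

  module ℙ where
    open CommutativeRing polyRing public
    open RingFacts polyRing public

  ^ₚ≋^ : ∀ p k → p ^ₚ k ≋ p ℙ.^ k
  ^ₚ≋^ p zero    = ≋-refl
  ^ₚ≋^ p (suc k) = *ₚ-congʳ p (^ₚ≋^ p k)

  eval-cong : ∀ {p q} x → p ≋ q → eval p x ≈ eval q x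
  eval-cong {p} {q} x (mk≋ p≈q) = go p q p≈q
    where
    vanishes : ∀ p → [] ≈ₚ p → eval p x ≈ 0#
    vanishes []      _    = refl
    vanishes (a ∷ p) 0≈p = trans (+-cong (sym (0≈p 0)) (*-congˡ (vanishes p (λ i → 0≈p (suc i)))))
                                 (trans (+-identityˡ _) (zeroʳ x))

    go : ∀ p q → p ≈ₚ q → eval p x ≈ eval q x
    go []      q       p≈q = sym (vanishes q p≈q)
    go (a ∷ p) []      p≈q = vanishes (a ∷ p) (λ i → sym (p≈q i))
    go (a ∷ p) (b ∷ q) p≈q = +-cong (p≈q 0) (*-congˡ (go p q (λ i → p≈q (suc i))))

  eval-+ₚ : ∀ p q x → eval (p +ₚ q) x ≈ eval p x + eval q x
  eval-+ₚ []      q       x = sym (+-identityˡ _)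
  eval-+ₚ (a ∷ p) []      x = sym (+-identityʳ _)
  eval-+ₚ (a ∷ p) (b ∷ q) x = trans (+-congˡ (*-congˡ (eval-+ₚ p q x)))
    (solve 5 (λ a b x P Q → (a :+ b) :+ x :* (P :+ Q) := (a :+ x :* P) :+ (b :+ x :* Q)) refl a b x (eval p x) (eval q x))

  eval-negₚ : ∀ p x → eval (-ₚ p) x ≈ - eval p x
  eval-negₚ []      x = sym -0#≈0#
  eval-negₚ (a ∷ p) x = trans (+-congˡ (trans (*-congˡ (eval-negₚ p x)) (sym (-‿distribʳ-* x (eval p x)))))
                            (⁻¹-∙-comm a (x * eval p x))

  eval-scale : ∀ a p x → eval (scale a p) x ≈ a * eval p x
  eval-scale a []      x = sym (zeroʳ a)
  eval-scale a (b ∷ p) x = trans (+-congˡ (*-congˡ (eval-scale a p x)))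
    (solve 4 (λ a b x P → a :* b :+ x :* (a :* P) := a :* (b :+ x :* P)) refl a b x (eval p x))

  eval-*ₚ : ∀ p q x → eval (p *ₚ q) x ≈ eval p x * eval q x
  eval-*ₚ []      q x = sym (zeroˡ _)
  eval-*ₚ (a ∷ p) q x = begin
    eval (scale a q +ₚ (0# ∷ p *ₚ q)) x           ≈⟨ eval-+ₚ (scale a q) (0# ∷ p *ₚ q) x ⟩
    eval (scale a q) x + (0# + x * eval (p *ₚ q) x) ≈⟨ +-cong (eval-scale a q x) (+-congˡ (*-congˡ (eval-*ₚ p q x))) ⟩
    a * Q + (0# + x * (P * Q))                     ≈⟨ solve 4 (λ a x P Q → a :* Q :+ (con 0 :+ x :* (P :* Q)) := (a :+ x :* P) :* Q) refl a x P Q ⟩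
    (a + x * P) * Q                                ∎
    where
    P = eval p x
    Q = eval q x

  eval-const : ∀ a x → eval (const a) x ≈ a
  eval-const a x = trans (+-congˡ (zeroʳ x)) (+-identityʳ a)

  eval-^ : ∀ p k x → eval (p ℙ.^ k) x ≈ eval p x ^ k
  eval-^ p zero    x = eval-const 1# x
  eval-^ p (suc k) x = trans (eval-*ₚ p (p ℙ.^ k) x) (*-congˡ (eval-^ p k x))

  eval-geometricSum : ∀ p q k x → eval (ℙ.geometricSum p q k) x ≈ geometricSum (eval p x) (eval q x) k
  eval-geometricSum p q zero    x = refl
  eval-geometricSum p q (suc k) x = trans (eval-+ₚ (p ℙ.^ k) (q *ₚ ℙ.geometricSum p q k) x)
    (+-cong (eval-^ p k x) (trans (eval-*ₚ q _ x) (*-congˡ (eval-geometricSum p q k x))))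

  linearFactor : Carrier → Pol
  linearFactor r = - r ∷ 1# ∷ []

  -- Horner's scheme: the coefficients of the quotient are the values at r of the tails of p.
  syntheticQuotient : Carrier → Pol → Pol
  syntheticQuotient r []      = []
  syntheticQuotient r (a ∷ p) = eval p r ∷ syntheticQuotient r p

  division-by-linearFactor : ∀ r p → linearFactor r *ₚ syntheticQuotient r p +ₚ const (eval p r) ≋ p
  division-by-linearFactor r []      = +ₚ-cong (*ₚ-zeroʳ (linearFactor r)) (≋-sym []≋[0])
  division-by-linearFactor r (a ∷ p) =
    ≋-trans (+ₚ-cong (*ₚ-∷ (linearFactor r) v q) (≋-refl {const (a + r * v)}))
            (∷-cong constant-term (≋-trans higher-terms (division-by-linearFactor r p)))
    where
    v = eval p r
    q = syntheticQuotient r p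
    higher-terms : (v * 1# ∷ []) +ₚ linearFactor r *ₚ q +ₚ [] ≋ linearFactor r *ₚ q +ₚ const v
    higher-terms = ≋-trans (+ₚ-identityʳ _) (≋-trans (+ₚ-comm (v * 1# ∷ []) (linearFactor r *ₚ q))
                                                     (+ₚ-cong (≋-refl {linearFactor r *ₚ q}) (∷-cong (*-identityʳ v) ≋-refl)))
    constant-term : v * - r + 0# + (a + r * v) ≈ a
    constant-term = begin
      v * - r + 0# + (a + r * v)    ≈⟨ +-congʳ (+-congʳ (-‿distribʳ-* v r)) ⟨
      - (v * r) + 0# + (a + r * v)  ≈⟨ solve 4 (λ n a r v → n :+ con 0 :+ (a :+ r :* v) := a :+ (n :+ v :* r)) refl (- (v * r)) a r v ⟩
      a + (- (v * r) + v * r)       ≈⟨ +-congˡ (-‿inverseˡ (v * r)) ⟩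
      a + 0#                        ≈⟨ +-identityʳ a ⟩
      a                             ∎

  root⇒linearFactor∣ : ∀ {r} p → eval p r ≈ 0# → linearFactor r ∣ₚ p
  root⇒linearFactor∣ {r} p p[r]≈0 = q , coeff-≈ (≋-trans lq≋lq+p[r] (division-by-linearFactor r p))
    where
    q = syntheticQuotient r p
    lq≋lq+p[r] : linearFactor r *ₚ q ≋ linearFactor r *ₚ q +ₚ const (eval p r)
    lq≋lq+p[r] = ≋-trans (≋-sym (+ₚ-identityʳ _)) (+ₚ-cong ≋-refl (≋-trans []≋[0] (∷-cong (sym p[r]≈0) ≋-refl)))

  linearFactor∤1ₚ : ¬ 1# ≈ 0# → ∀ r → ¬ linearFactor r ∣ₚ 1ₚ
  linearFactor∤1ₚ 1≉0 r (q , lq≈1) = 1≉0 (begin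
    1#                                     ≈⟨ eval-const 1# r ⟨
    eval 1ₚ r                              ≈⟨ eval-cong {linearFactor r *ₚ q} {1ₚ} r (mk≋ lq≈1) ⟨
    eval (linearFactor r *ₚ q) r           ≈⟨ eval-*ₚ (linearFactor r) q r ⟩
    eval (linearFactor r) r * eval q r     ≈⟨ *-congʳ linearFactor[r]≈0 ⟩
    0# * eval q r                          ≈⟨ zeroˡ _ ⟩
    0#                                     ∎)
    where
    linearFactor[r]≈0 : eval (linearFactor r) r ≈ 0#
    linearFactor[r]≈0 = trans (+-congˡ (trans (*-congˡ (eval-const 1# r)) (*-identityʳ r))) (-‿inverseˡ r)

  coprime⇒noCommonRoot : ¬ 1# ≈ 0# → ∀ f g → Coprime f g → ∀ r → eval f r ≈ 0# → ¬ eval g r ≈ 0#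
  coprime⇒noCommonRoot 1≉0 f g coprime r f[r]≈0 g[r]≈0 =
    linearFactor∤1ₚ 1≉0 r (coprime (linearFactor r) (root⇒linearFactor∣ f f[r]≈0) (root⇒linearFactor∣ g g[r]≈0))

  module _ (isField : IsField) where
    [a∷p]q≋0⇒q≋0 : ∀ {a} p q → ¬ a ≈ 0# → (a ∷ p) *ₚ q ≋ [] → q ≋ []
    [a∷p]q≋0⇒q≋0     p []      a≉0 _   = ≋-refl
    [a∷p]q≋0⇒q≋0 {a} p (b ∷ q) a≉0 a∷p*b∷q≋0 =
      ≋-trans (∷-cong b≈0 ([a∷p]q≋0⇒q≋0 p q a≉0 a∷p*q≋0)) (≋-sym []≋[0])
      where
      b≈0 : b ≈ 0#
      b≈0 = x≉0∧xy≈0⇒y≈0 isField a≉0 (trans (sym (+-identityʳ _)) (coeff-≈ a∷p*b∷q≋0 0))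
      a∷p*q≋0 : (a ∷ p) *ₚ q ≋ []
      a∷p*q≋0 = ≋-trans (+ₚ-cong (≋-refl {scale a q}) (≋-sym (≋-trans (*ₚ-∷ p b q) (+ₚ-cong (scale-≈0 p b≈0) ≋-refl))))
                        (mk≋ λ i → coeff-≈ a∷p*b∷q≋0 (suc i))

    polyRing-noZeroDivisors : ℙ.NoZeroDivisors
    polyRing-noZeroDivisors {[]}    {q} p≉0   q≉0 pq≋0 = p≉0 ≋-refl
    polyRing-noZeroDivisors {a ∷ p} {q} a∷p≉0 q≉0 a∷p*q≋0 = ¬¬-excluded-middle λ
      { (yes a≈0) → polyRing-noZeroDivisors (p≉0 a≈0) q≉0 (p*q≋0 a≈0)
      ; (no a≉0)  → q≉0 ([a∷p]q≋0⇒q≋0 p q a≉0 a∷p*q≋0) }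
      where
      p≉0 : a ≈ 0# → ¬ p ≋ []
      p≉0 a≈0 p≋0 = a∷p≉0 (≋-trans (∷-cong a≈0 p≋0) (≋-sym []≋[0]))
      p*q≋0 : a ≈ 0# → p *ₚ q ≋ []
      p*q≋0 a≈0 = mk≋ λ i → coeff-≈ (≋-trans (+ₚ-cong (≋-sym (scale-≈0 q a≈0)) ≋-refl) a∷p*q≋0) (suc i)

  const-*ₚ : ∀ a b → const a *ₚ const b ≋ const (a * b)
  const-*ₚ a b = ∷-cong (+-identityʳ _) ≋-refl

module PythagoreanPowers {c ℓ} (K : CommutativeRing c ℓ) where
  open CommutativeRing K
  open Poly K
  open RingFacts K
  open Polynomials K
  open import Algebra.Properties.Group +-group using (x∙y⁻¹≈ε⇒x≈y)
  open import Relation.Binary.Reasoning.Setoid setoid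

  module _ (isField : IsField) (char0 : Char0) {f g : Pol} (coprime : Coprime f g) where
    1≉0 : ¬ 1# ≈ 0#
    1≉0 = proj₁ isField

    noZeroDivisors : NoZeroDivisors
    noZeroDivisors = field⇒noZeroDivisors isField

    2≉0 : ¬ 1# + 1# ≈ 0#
    2≉0 2≈0 = char0 1 (trans (+-congˡ (+-identityʳ 1#)) 2≈0)

    A B C : Pol
    A = polA f g
    B = polB f g
    C = polC f g

    A²+B²≋C² : A *ₚ A +ₚ B *ₚ B ≋ C *ₚ C
    A²+B²≋C² = ℙ.pythagorean f g

    eval-A : ∀ r → eval A r ≈ eval f r * eval f r - eval g r * eval g r
    eval-A r = trans (eval-+ₚ (f *ₚ f) (-ₚ (g *ₚ g)) r)
                     (+-cong (eval-*ₚ f f r) (trans (eval-negₚ (g *ₚ g) r) (-‿cong (eval-*ₚ g g r))))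

    eval-B : ∀ r → eval B r ≈ (1# + 1#) * eval f r * eval g r
    eval-B r = trans (eval-*ₚ (const (1# + 1#) *ₚ f) g r)
                     (*-congʳ (trans (eval-*ₚ (const (1# + 1#)) f r) (*-congʳ (eval-const (1# + 1#) r))))

    module AtRootOfA {r} (A[r]≈0 : eval A r ≈ 0#) where
      f[r]²≈g[r]² : eval f r * eval f r ≈ eval g r * eval g r
      f[r]²≈g[r]² = x∙y⁻¹≈ε⇒x≈y _ _ (trans (sym (eval-A r)) A[r]≈0)

      f[r]≉0 : ¬ eval f r ≈ 0#
      f[r]≉0 f[r]≈0 = noZeroDivisors g[r]≉0 g[r]≉0 (trans (sym f[r]²≈g[r]²) (trans (*-congˡ f[r]≈0) (zeroʳ _)))
        where g[r]≉0 = coprime⇒noCommonRoot 1≉0 f g coprime r f[r]≈0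

      g[r]≉0 : ¬ eval g r ≈ 0#
      g[r]≉0 g[r]≈0 = noZeroDivisors f[r]≉0 f[r]≉0 (trans f[r]²≈g[r]² (trans (*-congˡ g[r]≈0) (zeroʳ _)))

      B[r]²≉0 : ¬ eval (B *ₚ B) r ≈ 0#
      B[r]²≉0 B[r]²≈0 = noZeroDivisors B[r]≉0 B[r]≉0 (trans (sym (eval-*ₚ B B r)) B[r]²≈0)
        where
        B[r]≉0 : ¬ eval B r ≈ 0#
        B[r]≉0 B[r]≈0 = noZeroDivisors (noZeroDivisors 2≉0 f[r]≉0) g[r]≉0 (trans (sym (eval-B r)) B[r]≈0)

      C[r]²≈B[r]² : eval (C *ₚ C) r ≈ eval (B *ₚ B) r
      C[r]²≈B[r]² = begin
        eval (C *ₚ C) r                        ≈⟨ eval-cong r A²+B²≋C² ⟨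
        eval (A *ₚ A +ₚ B *ₚ B) r              ≈⟨ eval-+ₚ (A *ₚ A) (B *ₚ B) r ⟩
        eval (A *ₚ A) r + eval (B *ₚ B) r      ≈⟨ +-congʳ (trans (eval-*ₚ A A r) (trans (*-congʳ A[r]≈0) (zeroˡ _))) ⟩
        0# + eval (B *ₚ B) r                   ≈⟨ +-identityˡ _ ⟩
        eval (B *ₚ B) r                        ∎

      geometricSum[C²,B²][r]≉0 : ∀ m₁ → ¬ eval (ℙ.geometricSum (C *ₚ C) (B *ₚ B) (suc m₁)) r ≈ 0#
      geometricSum[C²,B²][r]≉0 m₁ G[r]≈0 =
        noZeroDivisors (char0 m₁) (^-nonzero noZeroDivisors 1≉0 B[r]²≉0 m₁) (begin
          fromℕ (suc m₁) * β ^ m₁                                    ≈⟨ geometricSum-diagonal β m₁ ⟨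
          geometricSum β β (suc m₁)                                  ≈⟨ geometricSum-cong (suc m₁) C[r]²≈B[r]² refl ⟨
          geometricSum (eval (C *ₚ C) r) β (suc m₁)                  ≈⟨ eval-geometricSum (C *ₚ C) (B *ₚ B) (suc m₁) r ⟨
          eval (ℙ.geometricSum (C *ₚ C) (B *ₚ B) (suc m₁)) r         ≈⟨ G[r]≈0 ⟩
          0#                                                         ∎)
        where β = eval (B *ₚ B) r

      multiple-of-A-vanishes : ∀ p q s → eval (p *ₚ (A *ₚ q) *ₚ s) r ≈ 0#
      multiple-of-A-vanishes p q s = begin
        eval (p *ₚ (A *ₚ q) *ₚ s) r                    ≈⟨ eval-*ₚ (p *ₚ (A *ₚ q)) s r ⟩
        eval (p *ₚ (A *ₚ q)) r * eval s r              ≈⟨ *-congʳ (eval-*ₚ p (A *ₚ q) r) ⟩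
        eval p r * eval (A *ₚ q) r * eval s r          ≈⟨ *-congʳ (*-congˡ (eval-*ₚ A q r)) ⟩
        eval p r * (eval A r * eval q r) * eval s r    ≈⟨ *-congʳ (*-congˡ (*-congʳ A[r]≈0)) ⟩
        eval p r * (0# * eval q r) * eval s r          ≈⟨ *-congʳ (trans (*-congˡ (zeroˡ _)) (zeroʳ _)) ⟩
        0# * eval s r                                  ≈⟨ zeroˡ _ ⟩
        0#                                             ∎

    eval-A≈[f-g][f+g] : ∀ r → eval A r ≈ eval (f -ₚ g) r * eval (f +ₚ g) r
    eval-A≈[f-g][f+g] r = trans (eval-cong r (ℙ.sym (ℙ.[x-y][x+y]≈x²-y² f g))) (eval-*ₚ (f -ₚ g) (f +ₚ g) r)

    f-g,f+g-constant⇒f-constant : ∀ {a b} → f -ₚ g ≈ₚ const a → f +ₚ g ≈ₚ const b → ∃ λ e → f ≈ₚ const e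
    f-g,f+g-constant⇒f-constant {a} {b} f-g≈a f+g≈b with proj₂ isField (1# + 1#) 2≉0
    ... | ½ , 2*½≈1 = ½ * (a + b) , coeff-≈
      (≋-trans (ℙ.x≈u*[[x-y]+[x+y]] {const ½} f g ½*2≋1)
      (≋-trans (*ₚ-congʳ (const ½) (+ₚ-cong {f -ₚ g} {const a} {f +ₚ g} {const b} (mk≋ f-g≈a) (mk≋ f+g≈b)))
               (const-*ₚ ½ (a + b))))
      where
      ½*2≋1 : const ½ *ₚ (1ₚ +ₚ 1ₚ) ≋ 1ₚ
      ½*2≋1 = ≋-trans (const-*ₚ ½ (1# + 1#)) (∷-cong (trans (*-comm ½ _) 2*½≈1) ≋-refl)

    A-has-root : AlgClosed → NonConstant f → ¬ ¬ ∃ λ r → eval A r ≈ 0#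
    A-has-root algClosed f-nonconstant no-root =
      ¬¬-excluded-middle {A = ∃ λ a → f -ₚ g ≈ₚ const a} λ where
        (no f-g-nonconstant) → let r , [f-g][r]≈0 = algClosed (f -ₚ g) f-g-nonconstant in
          no-root (r , trans (eval-A≈[f-g][f+g] r) (trans (*-congʳ [f-g][r]≈0) (zeroˡ _)))
        (yes (a , f-g≈a)) → ¬¬-excluded-middle {A = ∃ λ b → f +ₚ g ≈ₚ const b} λ where
          (no f+g-nonconstant) → let r , [f+g][r]≈0 = algClosed (f +ₚ g) f+g-nonconstant in
            no-root (r , trans (eval-A≈[f-g][f+g] r) (trans (*-congˡ [f+g][r]≈0) (zeroʳ _)))
          (yes (b , f+g≈b)) → f-nonconstant (f-g,f+g-constant⇒f-constant f-g≈a f+g≈b)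

    A≉0 : AlgClosed → NonConstant f → ¬ A ≋ []
    A≉0 algClosed f-nonconstant A≋0 with algClosed f f-nonconstant
    ... | r , f[r]≈0 = AtRootOfA.f[r]≉0 (eval-cong r A≋0) f[r]≈0

    n≥3-impossible : AlgClosed → NonConstant f → ∀ {w} → ¬ w ≈ₚ 0ₚ → ∀ m n → 1 ≤ m → m ≤ n → 3 ≤ n →
      ¬ (w *ₚ A) ^ₚ n ≈ₚ (w *ₚ C) ^ₚ m -ₚ (w *ₚ B) ^ₚ m
    n≥3-impossible algClosed f-nonconstant {w} w≉0 m@(suc m₁) n@(suc (suc (suc k))) (s≤s z≤n) m≤n (s≤s (s≤s (s≤s _))) eq =
      A-has-root algClosed f-nonconstant λ (r , A[r]≈0) →
        ℙ.*-cancelˡ-nonzero (polyRing-noZeroDivisors isField) wᵐA²≉0 factorised λ Y[Cᵐ+Bᵐ]≋G →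
          AtRootOfA.geometricSum[C²,B²][r]≉0 A[r]≈0 m₁
            (trans (eval-cong r (≋-sym Y[Cᵐ+Bᵐ]≋G)) (AtRootOfA.multiple-of-A-vanishes A[r]≈0 (w ℙ.^ d) (A ℙ.^ k) _))
      where
      d = proj₁ (m≤n⇒∃[o]m+o≡n m≤n)

      eq′ : (w *ₚ A) ℙ.^ n +ₚ (w *ₚ B) ℙ.^ m ≋ (w *ₚ C) ℙ.^ m
      eq′ = ℙ.x≈y-z⇒x+z≈y (≋-trans (≋-sym (^ₚ≋^ (w *ₚ A) n))
                           (≋-trans (mk≋ eq) (+ₚ-cong (^ₚ≋^ (w *ₚ C) m) (-ₚ-cong (^ₚ≋^ (w *ₚ B) m)))))

      factorised : (w ℙ.^ m *ₚ (A *ₚ A)) *ₚ ((w ℙ.^ d *ₚ A ℙ.^ suc k) *ₚ (C ℙ.^ m +ₚ B ℙ.^ m))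
                 ≋ (w ℙ.^ m *ₚ (A *ₚ A)) *ₚ ℙ.geometricSum (C *ₚ C) (B *ₚ B) m
      factorised = ℙ.power-equation-factorised {w} {A} {B} {C} m d (suc k) (proj₂ (m≤n⇒∃[o]m+o≡n m≤n)) A²+B²≋C² eq′

      wᵐA²≉0 : ¬ w ℙ.^ m *ₚ (A *ₚ A) ≋ []
      wᵐA²≉0 = polyRing-noZeroDivisors isField
        (ℙ.^-nonzero (polyRing-noZeroDivisors isField) (λ 1≋0 → 1≉0 (coeff-≈ 1≋0 0)) {w} (λ w≋0 → w≉0 (coeff-≈ w≋0)) m)
        (polyRing-noZeroDivisors isField (A≉0 algClosed f-nonconstant) (A≉0 algClosed f-nonconstant))

    n≤2 : AlgClosed → NonConstant f → ∀ {w} → ¬ w ≈ₚ 0ₚ → ∀ m n → 1 ≤ m → m ≤ n →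
      (w *ₚ A) ^ₚ n ≈ₚ (w *ₚ C) ^ₚ m -ₚ (w *ₚ B) ^ₚ m → n ≤ 2
    n≤2 algClosed f-nonconstant {w} w≉0 m n 1≤m m≤n eq with n ≤? 2
    ... | yes n≤2 = n≤2
    ... | no  n≰2 = ⊥-elim (n≥3-impossible algClosed f-nonconstant {w} w≉0 m n 1≤m m≤n (≰⇒> n≰2) eq)

proposition3p5 : ∀ {c ℓ} (K : CommutativeRing c ℓ) → let open Poly K in
    IsField → Char0 → AlgClosed →
    (f g w : Pol) → NonConstant f → NonConstant g → Coprime f g →
    ¬ (w ≈ₚ 0ₚ) →
    (m n : ℕ) → 1 ≤ m → m ≤ n →
    (w *ₚ polA f g) ^ₚ n ≈ₚ (w *ₚ polC f g) ^ₚ m -ₚ (w *ₚ polB f g) ^ₚ m →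
    m ≤ 2
proposition3p5 K isField char0 algClosed f g w f-nonconstant _ coprime w≉0 m n 1≤m m≤n eq =
  ≤-trans m≤n (PythagoreanPowers.n≤2 K isField char0 {f} {g} coprime algClosed f-nonconstant {w} w≉0 m n 1≤m m≤n eq)
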